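{- Let $G$ be a cubic graph with $\tau(G)=4$ and let $M_1,M_2,M_3,M_4$ be perfect matchings of $G$ whose union is $E(G)$. Then for each $j\in\{1,2,3,4\}$, the three perfect matchings $M_i$, $i\neq j$, have empty common intersection: $\bigcap_{i\neq j}M_i=\emptyset$.
   Context: For a bridgeless cubic graph $G$, the perfect matching index $\tau(G)$ is the minimum number of perfect matchings of $G$ whose union is $E(G)$. -}

module Defs where

open import Data.Nat using (ℕ; _<_)
open import Data.Fin using (Fin)
open import Data.Fin.Properties using (_≟_)
open import Data.Bool using (Bool; true)
open import Data.Bool.Properties renaming (_≟_ to _≟ᵇ_)
open import Data.Product using (Σ; ∃; _×_; _,_; proj₁; proj₂)
open import Data.Sum using (_⊎_)
open import Data.List using (List; length; filter)
open import Data.List.Base using ()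
open import Data.Fin.Base using ()
open import Data.List using () renaming (map to lmap)
open import Data.Vec.Functional using ()
open import Relation.Nullary using (¬_; Dec)
open import Relation.Nullary.Decidable using (_⊎-dec_; _×-dec_)
open import Relation.Binary.PropositionalEquality using (_≡_; _≢_)
import Data.List as L

-- A finite multigraph (parallel edges allowed, no loops): vertices Fin n,
-- edges Fin m, each edge has two (distinct) endpoints.
record Graph : Set where
  field
    n     : ℕ
    m     : ℕ
    end₁  : Fin m → Fin n
    end₂  : Fin m → Fin n
    loopless : ∀ e → end₁ e ≢ end₂ e

open Graph public

Incident : (G : Graph) → Fin (m G) → Fin (n G) → Set
Incident G e v = (end₁ G e ≡ v) ⊎ (end₂ G e ≡ v)

incident? : (G : Graph) → ∀ e v → Dec (Incident G e v)
incident? G e v = (end₁ G e ≟ v) ⊎-dec (end₂ G e ≟ v)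

EdgeSet : Graph → Set
EdgeSet G = Fin (m G) → Bool

_∈ₑ_ : {G : Graph} → Fin (m G) → EdgeSet G → Set
e ∈ₑ M = M e ≡ true

degIn : (G : Graph) → EdgeSet G → Fin (n G) → ℕ
degIn G M v = length (filter (λ e → (M e ≟ᵇ true) ×-dec incident? G e v) (L.allFin (m G)))

deg : (G : Graph) → Fin (n G) → ℕ
deg G v = degIn G (λ _ → true) v

Cubic : Graph → Set
Cubic G = ∀ v → deg G v ≡ 3

IsPerfectMatching : (G : Graph) → EdgeSet G → Set
IsPerfectMatching G M = ∀ v → degIn G M v ≡ 1

IsPMCover : (G : Graph) (k : ℕ) → (Fin k → EdgeSet G) → Set
IsPMCover G k Ms = (∀ i → IsPerfectMatching G (Ms i)) × (∀ e → ∃ λ i → _∈ₑ_ {G} e (Ms i))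

HasPMCover : Graph → ℕ → Set
HasPMCover G k = Σ (Fin k → EdgeSet G) (IsPMCover G k)

PMIndex≡ : Graph → ℕ → Set
PMIndex≡ G k = HasPMCover G k × (∀ j → j < k → ¬ HasPMCover G j)

module Submission where

-- Suppose an edge e lies in every matching M_i with i ≠ j, and let
-- u be an endpoint of e.  Any other edge f at u is covered by some M_i; if
-- i ≠ j then M_i would contain the two distinct edges e and f at u, which a
-- perfect matching forbids, so f ∈ M_j.  Fixing one index k ≠ j (e ∈ M_k),
-- every edge at u therefore lies in M_j or M_k, whence
--   3 = deg u ≤ deg_{M_j} u + deg_{M_k} u = 1 + 1,
-- a contradiction.

open import Defs
open import Data.Bool using (true)
open import Data.Bool.Properties using () renaming (_≟_ to _≟ᵇ_)
open import Data.Empty using (⊥-elim)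
open import Data.Fin using (Fin; zero; suc)
open import Data.Fin.Properties using (_≟_)
open import Data.List using (List; []; _∷_; length; filter; allFin)
open import Data.List.Relation.Unary.Any using (here; there)
open import Data.List.Membership.Propositional using (_∈_)
open import Data.List.Membership.Propositional.Properties using (∈-allFin; ∈-filter⁺)
open import Data.Nat using (ℕ; suc; _≤_; _+_; z≤n; s≤s)
open import Data.Nat.Properties using (≤-trans; +-suc; n≤1+n; +-monoʳ-≤; m≤n+m)
open import Data.Product using (_,_; _×_)
open import Data.Sum using (_⊎_; inj₁; inj₂)
open import Relation.Nullary using (¬_; Dec; yes; no)
open import Relation.Nullary.Decidable using (_×-dec_)
open import Relation.Binary.PropositionalEquality
  using (_≡_; _≢_; refl; sym; subst; subst₂; cong₂)

filter-length-subadditive :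
  ∀ {A : Set} {P Q R : A → Set}
  (P? : ∀ x → Dec (P x)) (Q? : ∀ x → Dec (Q x)) (R? : ∀ x → Dec (R x)) →
  (∀ x → P x → Q x ⊎ R x) → (xs : List A) →
  length (filter P? xs) ≤ length (filter Q? xs) + length (filter R? xs)
filter-length-subadditive P? Q? R? P⊆Q∪R [] = z≤n
filter-length-subadditive P? Q? R? P⊆Q∪R (x ∷ xs)
  with ih ← filter-length-subadditive P? Q? R? P⊆Q∪R xs | P? x | Q? x | R? x
... | no _  | no _  | no _  = ih
... | no _  | yes _ | no _  = ≤-trans ih (n≤1+n _)
... | no _  | no _  | yes _ = ≤-trans ih (+-monoʳ-≤ _ (n≤1+n _))
... | no _  | yes _ | yes _ = ≤-trans ih (≤-trans (+-monoʳ-≤ _ (n≤1+n _)) (n≤1+n _))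
... | yes _ | yes _ | no _  = s≤s ih
... | yes _ | no _  | yes _ = subst (suc (length (filter P? xs)) ≤_) (sym (+-suc _ _)) (s≤s ih)
... | yes _ | yes _ | yes _ = s≤s (≤-trans ih (+-monoʳ-≤ _ (n≤1+n _)))
... | yes p | no ¬q | no ¬r with P⊆Q∪R x p
...   | inj₁ q = ⊥-elim (¬q q)
...   | inj₂ r = ⊥-elim (¬r r)

distinct-members⇒2≤length : ∀ {A : Set} {x y : A} {xs : List A} →
  x ∈ xs → y ∈ xs → x ≢ y → 2 ≤ length xs
distinct-members⇒2≤length (here refl) (here refl) x≢y = ⊥-elim (x≢y refl)
distinct-members⇒2≤length (here refl) (there {xs = _ ∷ _} _) _ = s≤s (s≤s z≤n)
distinct-members⇒2≤length (there {xs = _ ∷ _} _) (here refl) _ = s≤s (s≤s z≤n)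
distinct-members⇒2≤length {xs = _ ∷ xs} (there x∈) (there y∈) x≢y =
  ≤-trans (distinct-members⇒2≤length x∈ y∈ x≢y) (m≤n+m (length xs) 1)

AtVertex : (G : Graph) → EdgeSet G → Fin (n G) → Fin (m G) → Set
AtVertex G M v f = _∈ₑ_ {G} f M × Incident G f v

atVertex? : (G : Graph) (M : EdgeSet G) (v : Fin (n G)) → ∀ f → Dec (AtVertex G M v f)
atVertex? G M v f = (M f ≟ᵇ true) ×-dec incident? G f v

perfectMatching-unique-at :
  (G : Graph) (M : EdgeSet G) → IsPerfectMatching G M →
  ∀ v e f → AtVertex G M v e → AtVertex G M v f → e ≡ f
perfectMatching-unique-at G M pm v e f e-at-v f-at-v with e ≟ f
... | yes e≡f = e≡f
... | no e≢f = ⊥-elim (2≰1 (subst (2 ≤_) (pm v) two-edges))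
  where
  two-edges : 2 ≤ degIn G M v
  two-edges = distinct-members⇒2≤length
    (∈-filter⁺ (atVertex? G M v) (∈-allFin e) e-at-v)
    (∈-filter⁺ (atVertex? G M v) (∈-allFin f) f-at-v) e≢f
  2≰1 : ¬ (2 ≤ 1)
  2≰1 (s≤s ())

degree-subadditive :
  (G : Graph) (M N : EdgeSet G) (v : Fin (n G)) →
  (∀ f → Incident G f v → _∈ₑ_ {G} f M ⊎ _∈ₑ_ {G} f N) →
  deg G v ≤ degIn G M v + degIn G N v
degree-subadditive G M N v covered =
  filter-length-subadditive (atVertex? G (λ _ → true) v)
    (atVertex? G M v) (atVertex? G N v) split (allFin (m G))
  where
  split : ∀ f → AtVertex G (λ _ → true) v f → AtVertex G M v f ⊎ AtVertex G N v f
  split f (_ , f-at-v) with covered f f-at-v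
  ... | inj₁ f∈M = inj₁ (f∈M , f-at-v)
  ... | inj₂ f∈N = inj₂ (f∈N , f-at-v)

no-edge-in-all-but-one :
  (G : Graph) → Cubic G → (k : ℕ) (Ms : Fin k → EdgeSet G) → IsPMCover G k Ms →
  (j k₀ : Fin k) → k₀ ≢ j →
  (e : Fin (m G)) → ¬ (∀ i → i ≢ j → _∈ₑ_ {G} e (Ms i))
no-edge-in-all-but-one G cubic k Ms (pm , cover) j k₀ k₀≢j e e∈others =
  3≰2 (subst₂ _≤_ (cubic u) (cong₂ _+_ (pm j u) (pm k₀ u))
        (degree-subadditive G (Ms j) (Ms k₀) u edge-at-u-in-Mj-or-Mk₀))
  where
  u : Fin (n G)
  u = end₁ G e
  -- an edge f ≠ e at u cannot share a matching M_i (i ≠ j) with e, so f ∈ M_j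
  edge-at-u-in-Mj-or-Mk₀ : ∀ f → Incident G f u → _∈ₑ_ {G} f (Ms j) ⊎ _∈ₑ_ {G} f (Ms k₀)
  edge-at-u-in-Mj-or-Mk₀ f f-at-u with cover f
  ... | i , f∈Mi with i ≟ j
  ...   | yes refl = inj₁ f∈Mi
  ...   | no i≢j with perfectMatching-unique-at G (Ms i) (pm i) u e f
                        (e∈others i i≢j , inj₁ refl) (f∈Mi , f-at-u)
  ...     | refl = inj₂ (e∈others k₀ k₀≢j)
  3≰2 : ¬ (3 ≤ 2)
  3≰2 (s≤s (s≤s ()))

another : Fin 4 → Fin 4
another zero = suc zero
another (suc _) = zero

another≢ : ∀ j → another j ≢ j
another≢ zero ()
another≢ (suc _) ()

proposition3p3 : (G : Graph) → Cubic G → PMIndex≡ G 4 →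
    (Ms : Fin 4 → EdgeSet G) → IsPMCover G 4 Ms →
    (j : Fin 4) (e : Fin (m G)) → ¬ (∀ i → i ≢ j → _∈ₑ_ {G} e (Ms i))
proposition3p3 G cubic _ Ms cover j =
  no-edge-in-all-but-one G cubic 4 Ms cover j (another j) (another≢ j)
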